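{- Let $G(q)$ be the formal power series defined in the context and $G^{(2)}(q)=\frac{G(q)-1}{q^2}$. Then $$G^{(2)}(q)=\cfrac{1}{1+q-\cfrac{q^2}{1+q+\cfrac{q^3}{1+q-\cfrac{q^2}{1+q+\cfrac{q^3}{\ddots}}}}}$$ where all partial denominators are $1+q$ and the partial numerators after the first alternate $-q^2,+q^3,-q^2,+q^3,\dots$.
   Context: $G(q)\in\mathbb{Z}[[q]]$ is the Taylor expansion at $q=0$ of $\frac{q^2+q-1+\sqrt{(1-q+q^2)(1+3q+q^2)}}{2q}$ (square-root branch equal to $1$ at $q=0$); equivalently, the unique formal power series satisfying $q\,G(q)^2+(1-q-q^2)G(q)=1$. It begins $1+q^2-q^3+\cdots$. An infinite continued fraction in $q$ denotes the $q$-adic limit of its finite truncations. -}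

module Defs where

open import Data.Nat using (ℕ; zero; suc; _∸_; _≤_; _<_)
open import Data.Integer using (ℤ; +_; -_; _+_; _*_; _-_)
open import Data.List using (List; []; _∷_; map; upTo; zipWith; foldr)
open import Data.Product using (∃-syntax)
open import Relation.Binary.PropositionalEquality using (_≡_)

sumℤ : List ℤ → ℤ
sumℤ = foldr _+_ (+ 0)

-- Formal power series in ℤ[[q]]: the n-th coefficient is (f n).
PS : Set
PS = ℕ → ℤ

_≈ₚ_ : PS → PS → Set
f ≈ₚ g = ∀ n → f n ≡ g n

const : ℤ → PS
const c zero    = c
const c (suc _) = + 0

q : PS
q 1 = + 1
q _ = + 0

0ₚ 1ₚ : PS
0ₚ = const (+ 0)
1ₚ = const (+ 1)

_+ₚ_ : PS → PS → PS
(f +ₚ g) n = f n + g n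

-ₚ_ : PS → PS
(-ₚ f) n = - (f n)

_-ₚ_ : PS → PS → PS
f -ₚ g = f +ₚ (-ₚ g)

_*ₚ_ : PS → PS → PS
(f *ₚ g) n = sumℤ (map (λ i → f i * g (n ∸ i)) (upTo (suc n)))

infixl 6 _+ₚ_ _-ₚ_
infixl 7 _*ₚ_

-- Multiplicative inverse of a series whose constant term is a unit (±1) of ℤ:
-- c_0 = f_0 (= f_0⁻¹), c_n = - f_0 * Σ_{i=1}^{n} f_i c_{n-i}.
-- invRev f n = [c_n, c_{n-1}, …, c_0].
invRev : PS → ℕ → List ℤ
invRev f zero    = f 0 ∷ []
invRev f (suc n) =
  (- (f 0 * sumℤ (zipWith _*_ (map (λ i → f (suc i)) (upTo (suc n))) cs))) ∷ cs
  where cs = invRev f n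

headOr0 : List ℤ → ℤ
headOr0 []      = + 0
headOr0 (x ∷ _) = x

invₚ : PS → PS
invₚ f n = headOr0 (invRev f n)

_/ₚ_ : PS → PS → PS
f /ₚ g = f *ₚ invₚ g

-- q-adic convergence of a sequence of series: for every N, eventually all
-- terms agree with the limit modulo q^N (i.e. in all coefficients of index < N).
_⟶_ : (ℕ → PS) → PS → Set
T ⟶ F = ∀ N → ∃[ K ] (∀ k → K ≤ k → ∀ n → n < N → T k n ≡ F n)

cfDen : PS
cfDen = 1ₚ +ₚ q

altNum : ℕ → PS
altNum zero          = -ₚ (q *ₚ q)
altNum (suc zero)    = q *ₚ q *ₚ q
altNum (suc (suc m)) = altNum m

cfNum : ℕ → PS
cfNum zero    = 1ₚ
cfNum (suc m) = altNum m

-- cfFrom i d = a_i / (b + a_{i+1} / (b + … + a_{i+d-1} / b)), with d levels;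
-- cfFrom i 0 = 0.
cfFrom : ℕ → ℕ → PS
cfFrom i zero    = 0ₚ
cfFrom i (suc d) = cfNum i /ₚ (cfDen +ₚ cfFrom (suc i) d)

cfTrunc : ℕ → PS
cfTrunc k = cfFrom 0 k

-- G^{(2)} = (G - 1)/q² : coefficient shift by two.
shift2 : PS → PS
shift2 G n = G (suc (suc n))

{-# OPTIONS --safe #-}
-- Put H = G⁽²⁾, so that G = 1 + q²H (the coefficients G₀ = 1, G₁ = 0 are forced by the equation).
-- Substituting into qG² + (1 − q − q²)G = 1 and cancelling q² leaves H·D = 1 with
-- D = 1 + q − q² + q³H. Writing X₁ = −q² + q³H and X₂ = q³H, this gives
--   H = 1 / (1 + q + X₁),   X₂ = q³ / (1 + q + X₁),   X₁ = −q² / (1 + q + X₂),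
-- the last because (1 + q + q³H)(1 − qH) = 1 + q − qHD = 1. So (H, X₁, X₂) is a fixed point of
-- the recursion defining the truncations, which has period two after the first level. Every
-- numerator of that recursion is divisible by q, so each level gains one order of q-adic
-- agreement and the truncation with d + 1 levels agrees with H modulo q^d.
module Submission where

open import Defs
import Data.Nat as ℕ
open ℕ using (ℕ; zero; suc; _∸_; _≤_; _<_; z≤n; s≤s; _<?_)
import Data.Nat.Properties as ℕₚ
open import Data.Integer using (ℤ; +_; -_; _+_; _*_; _-_)
import Data.Integer.Properties as ℤₚ
open import Data.Integer.Tactic.RingSolver using (solve-∀)
open import Data.List using ([]; _∷_; map; upTo; applyUpTo; zipWith)
open import Data.List.Properties using (map-upTo)
open import Data.Maybe using (just; nothing)
open import Data.Product using (_×_; _,_; proj₁; proj₂)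
open import Function using (_∘_)
open import Level using (0ℓ)
open import Relation.Nullary using (yes; no)
open import Relation.Binary.Definitions using (WeaklyDecidable)
open import Relation.Binary.PropositionalEquality
open ≡-Reasoning
open import Algebra.Bundles using (CommutativeRing)
open import Algebra.Structures using (IsCommutativeRing)
open import Algebra.Properties.CommutativeSemigroup ℤₚ.+-commutativeSemigroup using (interchange)
import Algebra.Solver.Ring
import Algebra.Solver.Ring.AlmostCommutativeRing as ACR
import Relation.Binary.Reasoning.Setoid as SetoidReasoning

∑ : ℕ → (ℕ → ℤ) → ℤ
∑ zero    F = + 0
∑ (suc n) F = F 0 + ∑ n (F ∘ suc)

sumℤ-applyUpTo : ∀ n (F : ℕ → ℤ) → sumℤ (applyUpTo F n) ≡ ∑ n F
sumℤ-applyUpTo zero    F = refl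
sumℤ-applyUpTo (suc n) F = cong (_+_ (F 0)) (sumℤ-applyUpTo n (F ∘ suc))

∑-cong : ∀ n {F F′ : ℕ → ℤ} → (∀ i → i < n → F i ≡ F′ i) → ∑ n F ≡ ∑ n F′
∑-cong zero    eq = refl
∑-cong (suc n) eq = cong₂ _+_ (eq 0 (s≤s z≤n)) (∑-cong n (λ i i<n → eq (suc i) (s≤s i<n)))

∑-distrib-+ : ∀ n (F F′ : ℕ → ℤ) → ∑ n (λ i → F i + F′ i) ≡ ∑ n F + ∑ n F′
∑-distrib-+ zero    F F′ = refl
∑-distrib-+ (suc n) F F′ =
  trans (cong (_+_ (F 0 + F′ 0)) (∑-distrib-+ n (F ∘ suc) (F′ ∘ suc))) (interchange (F 0) (F′ 0) _ _)

*-distribˡ-∑ : ∀ n c (F : ℕ → ℤ) → c * ∑ n F ≡ ∑ n (λ i → c * F i)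
*-distribˡ-∑ zero    c F = ℤₚ.*-zeroʳ c
*-distribˡ-∑ (suc n) c F =
  trans (ℤₚ.*-distribˡ-+ c (F 0) _) (cong (_+_ (c * F 0)) (*-distribˡ-∑ n c (F ∘ suc)))

∑-init-last : ∀ n (F : ℕ → ℤ) → ∑ (suc n) F ≡ ∑ n F + F n
∑-init-last zero    F = trans (ℤₚ.+-identityʳ (F 0)) (sym (ℤₚ.+-identityˡ (F 0)))
∑-init-last (suc n) F =
  trans (cong (_+_ (F 0)) (∑-init-last n (F ∘ suc))) (sym (ℤₚ.+-assoc (F 0) _ _))

∑-zero : ∀ n (F : ℕ → ℤ) → (∀ i → F i ≡ + 0) → ∑ n F ≡ + 0
∑-zero zero    F F≡0 = refl
∑-zero (suc n) F F≡0 = cong₂ _+_ (F≡0 0) (∑-zero n (F ∘ suc) (F≡0 ∘ suc))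

tailₚ : PS → PS
tailₚ f n = f (suc n)

infixr 8 _·ₚ_
_·ₚ_ : ℤ → PS → PS
(c ·ₚ f) n = c * f n

0ₚ-coeff : ∀ n → 0ₚ n ≡ + 0
0ₚ-coeff zero    = refl
0ₚ-coeff (suc n) = refl

*ₚ-coeff : ∀ f g n → (f *ₚ g) n ≡ ∑ (suc n) (λ i → f i * g (n ∸ i))
*ₚ-coeff f g n = trans (cong sumℤ (map-upTo F (suc n))) (sumℤ-applyUpTo (suc n) F)
  where
  F : ℕ → ℤ
  F i = f i * g (n ∸ i)

*ₚ-coeff-zero : ∀ f g → (f *ₚ g) 0 ≡ f 0 * g 0
*ₚ-coeff-zero f g = ℤₚ.+-identityʳ (f 0 * g 0)

*ₚ-coeff-one : ∀ f g → (f *ₚ g) 1 ≡ f 0 * g 1 + f 1 * g 0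
*ₚ-coeff-one f g = cong (_+_ (f 0 * g 1)) (ℤₚ.+-identityʳ (f 1 * g 0))

*ₚ-coeff-sucˡ : ∀ f g n → (f *ₚ g) (suc n) ≡ f 0 * g (suc n) + (tailₚ f *ₚ g) n
*ₚ-coeff-sucˡ f g n =
  trans (*ₚ-coeff f g (suc n)) (cong (_+_ (f 0 * g (suc n))) (sym (*ₚ-coeff (tailₚ f) g n)))

*ₚ-coeff-sucʳ : ∀ f g n → (f *ₚ g) (suc n) ≡ (f *ₚ tailₚ g) n + f (suc n) * g 0
*ₚ-coeff-sucʳ f g n = begin
  (f *ₚ g) (suc n)
    ≡⟨ *ₚ-coeff f g (suc n) ⟩
  ∑ (suc (suc n)) (λ i → f i * g (suc n ∸ i))
    ≡⟨ ∑-init-last (suc n) (λ i → f i * g (suc n ∸ i)) ⟩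
  ∑ (suc n) (λ i → f i * g (suc n ∸ i)) + f (suc n) * g (n ∸ n)
    ≡⟨ cong₂ _+_ (∑-cong (suc n) λ i i<1+n → cong (λ k → f i * g k) (ℕₚ.+-∸-assoc 1 (ℕₚ.≤-pred i<1+n)))
                 (cong (λ k → f (suc n) * g k) (ℕₚ.n∸n≡0 n)) ⟩
  ∑ (suc n) (λ i → f i * tailₚ g (n ∸ i)) + f (suc n) * g 0
    ≡⟨ cong (_+ f (suc n) * g 0) (*ₚ-coeff f (tailₚ g) n) ⟨
  (f *ₚ tailₚ g) n + f (suc n) * g 0
    ∎

*ₚ-cong : ∀ {f f′ g g′} → f ≈ₚ f′ → g ≈ₚ g′ → (f *ₚ g) ≈ₚ (f′ *ₚ g′)
*ₚ-cong {f} {f′} {g} {g′} f≈f′ g≈g′ n = begin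
  (f *ₚ g) n                               ≡⟨ *ₚ-coeff f g n ⟩
  ∑ (suc n) (λ i → f i * g (n ∸ i))        ≡⟨ ∑-cong (suc n) (λ i _ → cong₂ _*_ (f≈f′ i) (g≈g′ (n ∸ i))) ⟩
  ∑ (suc n) (λ i → f′ i * g′ (n ∸ i))      ≡⟨ *ₚ-coeff f′ g′ n ⟨
  (f′ *ₚ g′) n                             ∎

*ₚ-identityˡ : ∀ g → (1ₚ *ₚ g) ≈ₚ g
*ₚ-identityˡ g n = begin
  (1ₚ *ₚ g) n                                     ≡⟨ *ₚ-coeff 1ₚ g n ⟩
  + 1 * g n + ∑ n (λ i → + 0 * g (n ∸ suc i))     ≡⟨ cong₂ _+_ (ℤₚ.*-identityˡ (g n)) (∑-zero n (λ i → + 0 * g (n ∸ suc i)) (λ i → ℤₚ.*-zeroˡ (g (n ∸ suc i)))) ⟩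
  g n + + 0                                       ≡⟨ ℤₚ.+-identityʳ (g n) ⟩
  g n                                             ∎

*ₚ-comm : ∀ f g → (f *ₚ g) ≈ₚ (g *ₚ f)
*ₚ-comm f g zero = trans (*ₚ-coeff-zero f g) (trans (ℤₚ.*-comm (f 0) (g 0)) (sym (*ₚ-coeff-zero g f)))
*ₚ-comm f g (suc n) = begin
  (f *ₚ g) (suc n)                        ≡⟨ *ₚ-coeff-sucˡ f g n ⟩
  f 0 * g (suc n) + (tailₚ f *ₚ g) n      ≡⟨ cong₂ _+_ (ℤₚ.*-comm (f 0) (g (suc n))) (*ₚ-comm (tailₚ f) g n) ⟩
  g (suc n) * f 0 + (g *ₚ tailₚ f) n      ≡⟨ ℤₚ.+-comm (g (suc n) * f 0) _ ⟩
  (g *ₚ tailₚ f) n + g (suc n) * f 0      ≡⟨ *ₚ-coeff-sucʳ g f n ⟨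
  (g *ₚ f) (suc n)                        ∎

*ₚ-distribˡ-+ₚ : ∀ f g h → (f *ₚ (g +ₚ h)) ≈ₚ (f *ₚ g +ₚ f *ₚ h)
*ₚ-distribˡ-+ₚ f g h n = begin
  (f *ₚ (g +ₚ h)) n
    ≡⟨ *ₚ-coeff f (g +ₚ h) n ⟩
  ∑ (suc n) (λ i → f i * (g (n ∸ i) + h (n ∸ i)))
    ≡⟨ ∑-cong (suc n) (λ i _ → ℤₚ.*-distribˡ-+ (f i) (g (n ∸ i)) (h (n ∸ i))) ⟩
  ∑ (suc n) (λ i → f i * g (n ∸ i) + f i * h (n ∸ i))
    ≡⟨ ∑-distrib-+ (suc n) (λ i → f i * g (n ∸ i)) (λ i → f i * h (n ∸ i)) ⟩
  ∑ (suc n) (λ i → f i * g (n ∸ i)) + ∑ (suc n) (λ i → f i * h (n ∸ i))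
    ≡⟨ cong₂ _+_ (*ₚ-coeff f g n) (*ₚ-coeff f h n) ⟨
  (f *ₚ g) n + (f *ₚ h) n
    ∎

*ₚ-distribʳ-+ₚ : ∀ h f g → ((f +ₚ g) *ₚ h) ≈ₚ (f *ₚ h +ₚ g *ₚ h)
*ₚ-distribʳ-+ₚ h f g n =
  trans (*ₚ-comm (f +ₚ g) h n)
    (trans (*ₚ-distribˡ-+ₚ h f g n) (cong₂ _+_ (*ₚ-comm h f n) (*ₚ-comm h g n)))

·ₚ-*ₚ-assoc : ∀ c f g → ((c ·ₚ f) *ₚ g) ≈ₚ (c ·ₚ (f *ₚ g))
·ₚ-*ₚ-assoc c f g n = begin
  ((c ·ₚ f) *ₚ g) n                          ≡⟨ *ₚ-coeff (c ·ₚ f) g n ⟩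
  ∑ (suc n) (λ i → c * f i * g (n ∸ i))      ≡⟨ ∑-cong (suc n) (λ i _ → ℤₚ.*-assoc c (f i) (g (n ∸ i))) ⟩
  ∑ (suc n) (λ i → c * (f i * g (n ∸ i)))    ≡⟨ *-distribˡ-∑ (suc n) c (λ i → f i * g (n ∸ i)) ⟨
  c * ∑ (suc n) (λ i → f i * g (n ∸ i))      ≡⟨ cong (c *_) (*ₚ-coeff f g n) ⟨
  c * (f *ₚ g) n                             ∎

*ₚ-assoc : ∀ f g h → ((f *ₚ g) *ₚ h) ≈ₚ (f *ₚ (g *ₚ h))
*ₚ-assoc f g h zero = begin
  ((f *ₚ g) *ₚ h) 0     ≡⟨ trans (*ₚ-coeff-zero (f *ₚ g) h) (cong (_* h 0) (*ₚ-coeff-zero f g)) ⟩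
  f 0 * g 0 * h 0       ≡⟨ ℤₚ.*-assoc (f 0) (g 0) (h 0) ⟩
  f 0 * (g 0 * h 0)     ≡⟨ trans (*ₚ-coeff-zero f (g *ₚ h)) (cong (f 0 *_) (*ₚ-coeff-zero g h)) ⟨
  (f *ₚ (g *ₚ h)) 0     ∎
*ₚ-assoc f g h (suc n) = begin
  ((f *ₚ g) *ₚ h) (suc n)
    ≡⟨ *ₚ-coeff-sucˡ (f *ₚ g) h n ⟩
  (f *ₚ g) 0 * h (suc n) + (tailₚ (f *ₚ g) *ₚ h) n
    ≡⟨ cong₂ _+_ (cong (_* h (suc n)) (*ₚ-coeff-zero f g))
                 (trans (*ₚ-cong {g = h} (*ₚ-coeff-sucˡ f g) (λ _ → refl) n)
                        (*ₚ-distribʳ-+ₚ h (f 0 ·ₚ tailₚ g) (tailₚ f *ₚ g) n)) ⟩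
  f 0 * g 0 * h (suc n) + (((f 0 ·ₚ tailₚ g) *ₚ h) n + ((tailₚ f *ₚ g) *ₚ h) n)
    ≡⟨ cong (_+_ (f 0 * g 0 * h (suc n)))
            (cong₂ _+_ (·ₚ-*ₚ-assoc (f 0) (tailₚ g) h n) (*ₚ-assoc (tailₚ f) g h n)) ⟩
  f 0 * g 0 * h (suc n) + (f 0 * (tailₚ g *ₚ h) n + (tailₚ f *ₚ (g *ₚ h)) n)
    ≡⟨ regroup (f 0) (g 0) (h (suc n)) _ _ ⟩
  f 0 * (g 0 * h (suc n) + (tailₚ g *ₚ h) n) + (tailₚ f *ₚ (g *ₚ h)) n
    ≡⟨ cong (λ c → f 0 * c + (tailₚ f *ₚ (g *ₚ h)) n) (*ₚ-coeff-sucˡ g h n) ⟨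
  f 0 * (g *ₚ h) (suc n) + (tailₚ f *ₚ (g *ₚ h)) n
    ≡⟨ *ₚ-coeff-sucˡ f (g *ₚ h) n ⟨
  (f *ₚ (g *ₚ h)) (suc n)
    ∎
  where
  regroup : ∀ a b c d e → a * b * c + (a * d + e) ≡ a * (b * c + d) + e
  regroup = solve-∀

+ₚ-*ₚ-isCommutativeRing : IsCommutativeRing _≈ₚ_ _+ₚ_ _*ₚ_ -ₚ_ 0ₚ 1ₚ
+ₚ-*ₚ-isCommutativeRing = record
  { isRing = record
    { +-isAbelianGroup = record
      { isGroup = record
        { isMonoid = record
          { isSemigroup = record
            { isMagma = record
              { isEquivalence = record
                { refl  = λ _ → refl
                ; sym   = λ f≈g n → sym (f≈g n)
                ; trans = λ f≈g g≈h n → trans (f≈g n) (g≈h n)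
                }
              ; ∙-cong = λ f≈f′ g≈g′ n → cong₂ _+_ (f≈f′ n) (g≈g′ n)
              }
            ; assoc = λ f g h n → ℤₚ.+-assoc (f n) (g n) (h n)
            }
          ; identity = (λ f n → trans (cong (_+ f n) (0ₚ-coeff n)) (ℤₚ.+-identityˡ (f n)))
                     , (λ f n → trans (cong (_+_ (f n)) (0ₚ-coeff n)) (ℤₚ.+-identityʳ (f n)))
          }
        ; inverse = (λ f n → trans (ℤₚ.+-inverseˡ (f n)) (sym (0ₚ-coeff n)))
                  , (λ f n → trans (ℤₚ.+-inverseʳ (f n)) (sym (0ₚ-coeff n)))
        ; ⁻¹-cong = λ f≈g n → cong -_ (f≈g n)
        }
      ; comm = λ f g n → ℤₚ.+-comm (f n) (g n)
      }
    ; *-cong     = *ₚ-cong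
    ; *-assoc    = *ₚ-assoc
    ; *-identity = *ₚ-identityˡ , (λ f n → trans (*ₚ-comm f 1ₚ n) (*ₚ-identityˡ f n))
    ; distrib    = *ₚ-distribˡ-+ₚ , *ₚ-distribʳ-+ₚ
    }
  ; *-comm = *ₚ-comm
  }

+ₚ-*ₚ-commutativeRing : CommutativeRing 0ℓ 0ℓ
+ₚ-*ₚ-commutativeRing = record { isCommutativeRing = +ₚ-*ₚ-isCommutativeRing }

module PS = CommutativeRing +ₚ-*ₚ-commutativeRing
open SetoidReasoning PS.setoid using (step-≈-⟩; step-≈-⟨) renaming (begin_ to beginₚ_; _∎ to _∎ₚ)

const-morphism : CommutativeRing.rawRing ℤₚ.+-*-commutativeRing
                   ACR.-Raw-AlmostCommutative⟶ ACR.fromCommutativeRing +ₚ-*ₚ-commutativeRing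
const-morphism = record
  { ⟦_⟧    = const
  ; +-homo = λ { a b zero → refl ; a b (suc n) → refl }
  ; *-homo = λ a b n → sym (const-* a b n)
  ; -‿homo = λ { a zero → refl ; a (suc n) → refl }
  ; 0-homo = λ { zero → refl ; (suc n) → refl }
  ; 1-homo = λ { zero → refl ; (suc n) → refl }
  }
  where
  const-* : ∀ a b → (const a *ₚ const b) ≈ₚ const (a * b)
  const-* a b zero    = *ₚ-coeff-zero (const a) (const b)
  const-* a b (suc n) = begin
    (const a *ₚ const b) (suc n)              ≡⟨ *ₚ-coeff-sucˡ (const a) (const b) n ⟩
    a * + 0 + (tailₚ (const a) *ₚ const b) n  ≡⟨ cong₂ _+_ (ℤₚ.*-zeroʳ a) (*ₚ-coeff (tailₚ (const a)) (const b) n) ⟩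
    + 0 + ∑ (suc n) (λ i → + 0 * b′ i)         ≡⟨ cong (_+_ (+ 0)) (∑-zero (suc n) (λ i → + 0 * b′ i) (ℤₚ.*-zeroˡ ∘ b′)) ⟩
    + 0                                       ∎
    where
    b′ : ℕ → ℤ
    b′ i = const b (n ∸ i)

const-≈? : WeaklyDecidable (λ a b → const a ≈ₚ const b)
const-≈? a b with a ℤₚ.≟ b
... | yes a≡b = just (λ n → cong (λ c → const c n) a≡b)
... | no _    = nothing

module PSSolver = Algebra.Solver.Ring
  (CommutativeRing.rawRing ℤₚ.+-*-commutativeRing)
  (ACR.fromCommutativeRing +ₚ-*ₚ-commutativeRing) const-morphism const-≈?

tailₚ-q : tailₚ q ≈ₚ 1ₚ
tailₚ-q zero    = refl
tailₚ-q (suc n) = refl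

q*ₚ-coeff-zero : ∀ f → (q *ₚ f) 0 ≡ + 0
q*ₚ-coeff-zero f = trans (*ₚ-coeff-zero q f) (ℤₚ.*-zeroˡ (f 0))

q*ₚ-coeff-suc : ∀ f n → (q *ₚ f) (suc n) ≡ f n
q*ₚ-coeff-suc f n = begin
  (q *ₚ f) (suc n)                     ≡⟨ *ₚ-coeff-sucˡ q f n ⟩
  + 0 * f (suc n) + (tailₚ q *ₚ f) n   ≡⟨ cong₂ _+_ (ℤₚ.*-zeroˡ (f (suc n))) (*ₚ-cong tailₚ-q (PS.refl {f}) n) ⟩
  + 0 + (1ₚ *ₚ f) n                    ≡⟨ ℤₚ.+-identityˡ _ ⟩
  (1ₚ *ₚ f) n                          ≡⟨ *ₚ-identityˡ f n ⟩
  f n                                  ∎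

q*ₚ-cancel : ∀ {f g} → (q *ₚ f) ≈ₚ (q *ₚ g) → f ≈ₚ g
q*ₚ-cancel {f} {g} qf≈qg n = trans (sym (q*ₚ-coeff-suc f n)) (trans (qf≈qg (suc n)) (q*ₚ-coeff-suc g n))

zipWith-applyUpTo : ∀ {A B C : Set} (_⊕_ : A → B → C) (F : ℕ → A) (F′ : ℕ → B) n →
                    zipWith _⊕_ (applyUpTo F n) (applyUpTo F′ n) ≡ applyUpTo (λ i → F i ⊕ F′ i) n
zipWith-applyUpTo _⊕_ F F′ zero    = refl
zipWith-applyUpTo _⊕_ F F′ (suc n) = cong (F 0 ⊕ F′ 0 ∷_) (zipWith-applyUpTo _⊕_ (F ∘ suc) (F′ ∘ suc) n)

applyUpTo-cong : ∀ {A : Set} n {F F′ : ℕ → A} → (∀ i → i < n → F i ≡ F′ i) → applyUpTo F n ≡ applyUpTo F′ n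
applyUpTo-cong zero    eq = refl
applyUpTo-cong (suc n) eq = cong₂ _∷_ (eq 0 (s≤s z≤n)) (applyUpTo-cong n (λ i i<n → eq (suc i) (s≤s i<n)))

invRev-applyUpTo : ∀ f n → invRev f n ≡ applyUpTo (λ j → invₚ f (n ∸ j)) (suc n)
invRev-applyUpTo f zero    = refl
invRev-applyUpTo f (suc n) = cong (invₚ f (suc n) ∷_) (invRev-applyUpTo f n)

invₚ-coeff-suc : ∀ f n → invₚ f (suc n) ≡ - (f 0 * (tailₚ f *ₚ invₚ f) n)
invₚ-coeff-suc f n = cong (λ s → - (f 0 * s)) (begin
  sumℤ (zipWith _*_ (map (f ∘ suc) (upTo (suc n))) (invRev f n))
    ≡⟨ cong₂ (λ xs ys → sumℤ (zipWith _*_ xs ys)) (map-upTo (f ∘ suc) (suc n)) (invRev-applyUpTo f n) ⟩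
  sumℤ (zipWith _*_ (applyUpTo (f ∘ suc) (suc n)) (applyUpTo (λ j → invₚ f (n ∸ j)) (suc n)))
    ≡⟨ cong sumℤ (zipWith-applyUpTo _*_ (f ∘ suc) (λ j → invₚ f (n ∸ j)) (suc n)) ⟩
  sumℤ (applyUpTo (λ i → f (suc i) * invₚ f (n ∸ i)) (suc n))
    ≡⟨ cong sumℤ (map-upTo (λ i → f (suc i) * invₚ f (n ∸ i)) (suc n)) ⟨
  (tailₚ f *ₚ invₚ f) n
    ∎)

*ₚ-invₚ : ∀ f → f 0 * f 0 ≡ + 1 → (f *ₚ invₚ f) ≈ₚ 1ₚ
*ₚ-invₚ f unit zero    = trans (*ₚ-coeff-zero f (invₚ f)) unit
*ₚ-invₚ f unit (suc n) = begin
  (f *ₚ invₚ f) (suc n)                  ≡⟨ *ₚ-coeff-sucˡ f (invₚ f) n ⟩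
  f 0 * invₚ f (suc n) + s               ≡⟨ cong (λ c → f 0 * c + s) (invₚ-coeff-suc f n) ⟩
  f 0 * - (f 0 * s) + s                  ≡⟨ expand (f 0) s ⟩
  (+ 1 - f 0 * f 0) * s                  ≡⟨ cong (λ u → (+ 1 - u) * s) unit ⟩
  + 0 * s                                ≡⟨ ℤₚ.*-zeroˡ s ⟩
  + 0                                    ∎
  where
  s : ℤ
  s = (tailₚ f *ₚ invₚ f) n
  expand : ∀ a s → a * - (a * s) + s ≡ (+ 1 - a * a) * s
  expand = solve-∀

invₚ-unique : ∀ f h → f 0 * f 0 ≡ + 1 → (f *ₚ h) ≈ₚ 1ₚ → invₚ f ≈ₚ h
invₚ-unique f h unit fh≈1 = beginₚ
  invₚ f                ≈⟨ PS.*-identityʳ (invₚ f) ⟨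
  invₚ f *ₚ 1ₚ          ≈⟨ PS.*-congˡ {invₚ f} fh≈1 ⟨
  invₚ f *ₚ (f *ₚ h)    ≈⟨ PS.*-assoc (invₚ f) f h ⟨
  invₚ f *ₚ f *ₚ h      ≈⟨ PS.*-congʳ (PS.trans (PS.*-comm (invₚ f) f) (*ₚ-invₚ f unit)) ⟩
  1ₚ *ₚ h               ≈⟨ PS.*-identityˡ h ⟩
  h                     ∎ₚ

infix 4 _≡_mod-q^_
_≡_mod-q^_ : PS → PS → ℕ → Set
f ≡ g mod-q^ N = ∀ n → n < N → f n ≡ g n

≈ₚ⇒≡mod : ∀ {f g} N → f ≈ₚ g → f ≡ g mod-q^ N
≈ₚ⇒≡mod N f≈g n _ = f≈g n

≡mod-trans : ∀ {f g h N} → f ≡ g mod-q^ N → g ≡ h mod-q^ N → f ≡ h mod-q^ N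
≡mod-trans f≡g g≡h n n<N = trans (f≡g n n<N) (g≡h n n<N)

≡mod-weaken : ∀ {f g N M} → N ≤ M → f ≡ g mod-q^ M → f ≡ g mod-q^ N
≡mod-weaken N≤M f≡g n n<N = f≡g n (ℕₚ.<-≤-trans n<N N≤M)

+ₚ-congˡ-mod : ∀ f {g g′ N} → g ≡ g′ mod-q^ N → f +ₚ g ≡ f +ₚ g′ mod-q^ N
+ₚ-congˡ-mod f g≡g′ n n<N = cong (_+_ (f n)) (g≡g′ n n<N)

*ₚ-congˡ-mod : ∀ k a {g g′ N} → a ≡ 0ₚ mod-q^ k → g ≡ g′ mod-q^ N → a *ₚ g ≡ a *ₚ g′ mod-q^ (k ℕ.+ N)
*ₚ-congˡ-mod k a {g} {g′} {N} a≡0 g≡g′ n n<k+N = begin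
  (a *ₚ g) n                          ≡⟨ *ₚ-coeff a g n ⟩
  ∑ (suc n) (λ i → a i * g (n ∸ i))   ≡⟨ ∑-cong (suc n) (λ i i<1+n → term i (ℕₚ.≤-pred i<1+n)) ⟩
  ∑ (suc n) (λ i → a i * g′ (n ∸ i))  ≡⟨ *ₚ-coeff a g′ n ⟨
  (a *ₚ g′) n                         ∎
  where
  term : ∀ i → i ≤ n → a i * g (n ∸ i) ≡ a i * g′ (n ∸ i)
  term i i≤n with i <? k
  ... | yes i<k = let aᵢ≡0 = trans (a≡0 i i<k) (0ₚ-coeff i) in
                  trans (cong (_* g (n ∸ i)) aᵢ≡0) (sym (cong (_* g′ (n ∸ i)) aᵢ≡0))
  ... | no  i≮k = cong (a i *_) (g≡g′ (n ∸ i) (ℕₚ.≤-<-trans (ℕₚ.∸-monoʳ-≤ n (ℕₚ.≮⇒≥ i≮k)) n∸k<N))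
    where
    n∸k<N : n ∸ k < N
    n∸k<N = subst (n ∸ k <_) (ℕₚ.m+n∸m≡n k N)
              (ℕₚ.∸-monoˡ-< n<k+N (ℕₚ.≤-trans (ℕₚ.≮⇒≥ i≮k) i≤n))

invRev-cong : ∀ n {f f′} → f ≡ f′ mod-q^ suc n → invRev f n ≡ invRev f′ n
invRev-cong zero    f≡f′ = cong (_∷ []) (f≡f′ 0 (s≤s z≤n))
invRev-cong (suc n) {f} {f′} f≡f′ =
  cong₂ _∷_ (cong₂ (λ a s → - (a * s)) (f≡f′ 0 (s≤s z≤n))
                   (cong₂ (λ xs ys → sumℤ (zipWith _*_ xs ys)) tails≡ invRev≡))
            invRev≡
  where
  invRev≡ : invRev f n ≡ invRev f′ n
  invRev≡ = invRev-cong n (≡mod-weaken (ℕₚ.n≤1+n _) f≡f′)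
  tails≡ : map (f ∘ suc) (upTo (suc n)) ≡ map (f′ ∘ suc) (upTo (suc n))
  tails≡ = trans (map-upTo _ (suc n))
             (trans (applyUpTo-cong (suc n) (λ i i<1+n → f≡f′ (suc i) (s≤s i<1+n)))
                    (sym (map-upTo _ (suc n))))

invₚ-cong-mod : ∀ {f f′ N} → f ≡ f′ mod-q^ N → invₚ f ≡ invₚ f′ mod-q^ N
invₚ-cong-mod f≡f′ n n<N = cong headOr0 (invRev-cong n (≡mod-weaken n<N f≡f′))

/ₚ-contract : ∀ k a b {T Y X N} → a ≡ 0ₚ mod-q^ k → X ≈ₚ (a /ₚ (b +ₚ Y)) → T ≡ Y mod-q^ N →
              a /ₚ (b +ₚ T) ≡ X mod-q^ (k ℕ.+ N)
/ₚ-contract k a b a≡0 X≈a/[b+Y] T≡Y =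
  ≡mod-trans (*ₚ-congˡ-mod k a a≡0 (invₚ-cong-mod (+ₚ-congˡ-mod b T≡Y)))
             (≈ₚ⇒≡mod _ (PS.sym X≈a/[b+Y]))

cfFrom-periodic : ∀ i d → cfFrom (3 ℕ.+ i) d ≡ cfFrom (1 ℕ.+ i) d
cfFrom-periodic i zero    = refl
cfFrom-periodic i (suc d) = cong (λ t → altNum i /ₚ (cfDen +ₚ t)) (cfFrom-periodic (suc i) d)

cfTrunc-converges : ∀ {H X₁ X₂} →
                    H  ≈ₚ (1ₚ       /ₚ (cfDen +ₚ X₁)) →
                    X₁ ≈ₚ (altNum 0 /ₚ (cfDen +ₚ X₂)) →
                    X₂ ≈ₚ (altNum 1 /ₚ (cfDen +ₚ X₁)) →
                    cfTrunc ⟶ H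
cfTrunc-converges {H} {X₁} {X₂} H-fixed X₁-fixed X₂-fixed N = suc N , converged
  where
  q∣altNum : ∀ m → altNum m ≡ 0ₚ mod-q^ 1
  q∣altNum zero          zero _ = refl
  q∣altNum (suc zero)    zero _ = refl
  q∣altNum (suc (suc m)) zero _ = q∣altNum m zero (s≤s z≤n)
  q∣altNum _             (suc _) (s≤s ())

  tails : ∀ d → cfFrom 1 d ≡ X₁ mod-q^ d × cfFrom 2 d ≡ X₂ mod-q^ d
  tails zero    = (λ _ ()) , (λ _ ())
  tails (suc d) =
    /ₚ-contract 1 (altNum 0) cfDen (q∣altNum 0) X₁-fixed (proj₂ (tails d)) ,
    /ₚ-contract 1 (altNum 1) cfDen (q∣altNum 1) X₂-fixed
      (subst (λ t → t ≡ X₁ mod-q^ d) (sym (cfFrom-periodic 0 d)) (proj₁ (tails d)))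

  converged : ∀ k → suc N ≤ k → cfTrunc k ≡ H mod-q^ N
  converged (suc d) (s≤s N≤d) =
    ≡mod-weaken N≤d (/ₚ-contract 0 1ₚ cfDen (λ _ ()) H-fixed (proj₁ (tails d)))

X₁ X₂ : PS → PS
X₁ H = altNum 0 +ₚ altNum 1 *ₚ H
X₂ H = altNum 1 *ₚ H

module FixedPoint (H : PS) (H*D≈1 : (H *ₚ (cfDen +ₚ X₁ H)) ≈ₚ 1ₚ) where
  open PSSolver using (solve; _:=_; con; _:+_; _:*_; _:-_; :-_)

  invₚ-D≈H : invₚ (cfDen +ₚ X₁ H) ≈ₚ H
  invₚ-D≈H = invₚ-unique (cfDen +ₚ X₁ H) H refl (PS.trans (PS.*-comm (cfDen +ₚ X₁ H) H) H*D≈1)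

  H-fixed : H ≈ₚ (1ₚ /ₚ (cfDen +ₚ X₁ H))
  H-fixed = PS.sym (PS.trans (PS.*-identityˡ (invₚ (cfDen +ₚ X₁ H))) invₚ-D≈H)

  X₂-fixed : X₂ H ≈ₚ (altNum 1 /ₚ (cfDen +ₚ X₁ H))
  X₂-fixed = PS.*-congˡ {altNum 1} (PS.sym invₚ-D≈H)

  inverse-of-D₂ : ((cfDen +ₚ X₂ H) *ₚ (1ₚ -ₚ q *ₚ H)) ≈ₚ 1ₚ
  inverse-of-D₂ = beginₚ
    (cfDen +ₚ X₂ H) *ₚ (1ₚ -ₚ q *ₚ H)     ≈⟨ expand q H ⟩
    cfDen -ₚ q *ₚ (H *ₚ (cfDen +ₚ X₁ H))   ≈⟨ PS.+-congˡ {cfDen} (PS.-‿cong (PS.*-congˡ {q} H*D≈1)) ⟩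
    cfDen -ₚ q *ₚ 1ₚ                       ≈⟨ collapse q ⟩
    1ₚ                                     ∎ₚ
    where
    expand : ∀ x h → (((1ₚ +ₚ x) +ₚ x *ₚ x *ₚ x *ₚ h) *ₚ (1ₚ -ₚ x *ₚ h))
                     ≈ₚ ((1ₚ +ₚ x) -ₚ x *ₚ (h *ₚ ((1ₚ +ₚ x) +ₚ (-ₚ (x *ₚ x) +ₚ x *ₚ x *ₚ x *ₚ h))))
    expand = solve 2 (λ x h →
      ((con (+ 1) :+ x) :+ x :* x :* x :* h) :* (con (+ 1) :- x :* h)
      := (con (+ 1) :+ x) :- x :* (h :* ((con (+ 1) :+ x) :+ (:- (x :* x) :+ x :* x :* x :* h))))
      (λ _ → refl)
    collapse : ∀ x → ((1ₚ +ₚ x) -ₚ x *ₚ 1ₚ) ≈ₚ 1ₚ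
    collapse = solve 1 (λ x → (con (+ 1) :+ x) :- x :* con (+ 1) := con (+ 1)) (λ _ → refl)

  X₁-fixed : X₁ H ≈ₚ (altNum 0 /ₚ (cfDen +ₚ X₂ H))
  X₁-fixed = beginₚ
    X₁ H                              ≈⟨ expand q H ⟨
    altNum 0 *ₚ (1ₚ -ₚ q *ₚ H)
      ≈⟨ PS.*-congˡ {altNum 0} (invₚ-unique (cfDen +ₚ X₂ H) (1ₚ -ₚ q *ₚ H) refl inverse-of-D₂) ⟨
    altNum 0 /ₚ (cfDen +ₚ X₂ H)        ∎ₚ
    where
    expand : ∀ x h → ((-ₚ (x *ₚ x)) *ₚ (1ₚ -ₚ x *ₚ h)) ≈ₚ (-ₚ (x *ₚ x) +ₚ x *ₚ x *ₚ x *ₚ h)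
    expand = solve 2 (λ x h → (:- (x :* x)) :* (con (+ 1) :- x :* h) := :- (x :* x) :+ x :* x :* x :* h)
                     (λ _ → refl)

quadratic : PS → PS
quadratic g = q *ₚ g *ₚ g +ₚ (1ₚ -ₚ q -ₚ q *ₚ q) *ₚ g

module FunctionalEquation (G : PS) (G-solves : quadratic G ≈ₚ 1ₚ) where
  open PSSolver using (solve; _:=_; con; _:+_; _:*_; _:-_; :-_)

  G₀≡1 : G 0 ≡ + 1
  G₀≡1 = trans (sym coefficient₀) (G-solves 0)
    where
    simplify : ∀ a → + 0 * a * a + + 1 * a ≡ a
    simplify = solve-∀
    coefficient₀ : quadratic G 0 ≡ G 0
    coefficient₀ = begin
      quadratic G 0
        ≡⟨ cong₂ _+_ (*ₚ-coeff-zero (q *ₚ G) G) (*ₚ-coeff-zero (1ₚ -ₚ q -ₚ q *ₚ q) G) ⟩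
      (q *ₚ G) 0 * G 0 + + 1 * G 0  ≡⟨ cong (λ c → c * G 0 + + 1 * G 0) (q*ₚ-coeff-zero G) ⟩
      + 0 * G 0 + + 1 * G 0         ≡⟨ simplify (G 0) ⟩
      G 0                           ∎

  G₁≡0 : G 1 ≡ + 0
  G₁≡0 = trans (sym coefficient₁) (G-solves 1)
    where
    simplify : ∀ b → + 0 * b + + 1 * + 1 + (+ 1 * b + - (+ 1) * + 1) ≡ b
    simplify = solve-∀
    coefficient₁ : quadratic G 1 ≡ G 1
    coefficient₁ = begin
      quadratic G 1
        ≡⟨ cong₂ _+_ (*ₚ-coeff-one (q *ₚ G) G) (*ₚ-coeff-one (1ₚ -ₚ q -ₚ q *ₚ q) G) ⟩
      (q *ₚ G) 0 * G 1 + (q *ₚ G) 1 * G 0 + (+ 1 * G 1 + - (+ 1) * G 0)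
        ≡⟨ cong₂ (λ c d → c * G 1 + d * G 0 + (+ 1 * G 1 + - (+ 1) * G 0))
                 (q*ₚ-coeff-zero G) (q*ₚ-coeff-suc G 0) ⟩
      + 0 * G 1 + G 0 * G 0 + (+ 1 * G 1 + - (+ 1) * G 0)
        ≡⟨ cong (λ a → + 0 * G 1 + a * a + (+ 1 * G 1 + - (+ 1) * a)) G₀≡1 ⟩
      + 0 * G 1 + + 1 * + 1 + (+ 1 * G 1 + - (+ 1) * + 1)
        ≡⟨ simplify (G 1) ⟩
      G 1
        ∎

  H : PS
  H = shift2 G

  q*H≈tailG : (q *ₚ H) ≈ₚ tailₚ G
  q*H≈tailG zero    = trans (q*ₚ-coeff-zero H) (sym G₁≡0)
  q*H≈tailG (suc n) = q*ₚ-coeff-suc H n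

  G≈1+q²H : G ≈ₚ (1ₚ +ₚ q *ₚ (q *ₚ H))
  G≈1+q²H zero    = trans G₀≡1 (cong (_+_ (+ 1)) (sym (q*ₚ-coeff-zero (q *ₚ H))))
  G≈1+q²H (suc n) = sym (trans (ℤₚ.+-identityˡ _) (trans (q*ₚ-coeff-suc (q *ₚ H) n) (q*H≈tailG n)))

  quadratic-cong : ∀ {g g′} → g ≈ₚ g′ → quadratic g ≈ₚ quadratic g′
  quadratic-cong g≈g′ =
    PS.+-cong (*ₚ-cong (*ₚ-cong (PS.refl {q}) g≈g′) g≈g′) (*ₚ-cong (PS.refl {1ₚ -ₚ q -ₚ q *ₚ q}) g≈g′)

  H*D≈1 : (H *ₚ (cfDen +ₚ X₁ H)) ≈ₚ 1ₚ
  H*D≈1 = q*ₚ-cancel (q*ₚ-cancel (beginₚ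
    q *ₚ (q *ₚ (H *ₚ (cfDen +ₚ X₁ H)))        ≈⟨ expand q H ⟩
    quadratic (1ₚ +ₚ q *ₚ (q *ₚ H)) +ₚ q *ₚ q -ₚ 1ₚ
      ≈⟨ PS.+-congʳ (PS.+-congʳ (PS.trans (quadratic-cong (PS.sym G≈1+q²H)) G-solves)) ⟩
    1ₚ +ₚ q *ₚ q -ₚ 1ₚ                         ≈⟨ collapse q ⟩
    q *ₚ (q *ₚ 1ₚ)                             ∎ₚ))
    where
    expand : ∀ x h → let g = 1ₚ +ₚ x *ₚ (x *ₚ h) in
             (x *ₚ (x *ₚ (h *ₚ ((1ₚ +ₚ x) +ₚ (-ₚ (x *ₚ x) +ₚ x *ₚ x *ₚ x *ₚ h)))))
             ≈ₚ (x *ₚ g *ₚ g +ₚ (1ₚ -ₚ x -ₚ x *ₚ x) *ₚ g +ₚ x *ₚ x -ₚ 1ₚ)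
    expand = solve 2 (λ x h → let g = con (+ 1) :+ x :* (x :* h) in
      x :* (x :* (h :* ((con (+ 1) :+ x) :+ (:- (x :* x) :+ x :* x :* x :* h))))
      := x :* g :* g :+ (con (+ 1) :- x :- x :* x) :* g :+ x :* x :- con (+ 1))
      (λ _ → refl)
    collapse : ∀ x → (1ₚ +ₚ x *ₚ x -ₚ 1ₚ) ≈ₚ (x *ₚ (x *ₚ 1ₚ))
    collapse = solve 1 (λ x → con (+ 1) :+ x :* x :- con (+ 1) := x :* (x :* con (+ 1))) (λ _ → refl)

proposition1p3 : (G : PS)
    → (q *ₚ G *ₚ G +ₚ (1ₚ -ₚ q -ₚ q *ₚ q) *ₚ G) ≈ₚ 1ₚ
    → cfTrunc ⟶ shift2 G
proposition1p3 G G-solves = cfTrunc-converges H-fixed X₁-fixed X₂-fixed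
  where open FixedPoint (shift2 G) (FunctionalEquation.H*D≈1 G G-solves)
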